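{- Let $\omega$ be a finite sequence of numbers and $k\ge1$ an integer. Let $\{L_1,\dots,L_k\}$ be an optimal solution of the $k$-LIS problem on $\omega$, with $|\mathsf{OPT}|=|L_1|+\cdots+|L_k|$, and let $A_1,\dots,A_k$ be the subsequences produced by the greedy algorithm ($A_i$ chosen at step $i$). For $0\le x\le k$ let $g_x=|A_1|+\cdots+|A_x|$ and $r_x(L_i)=L_i\setminus(A_1\cup\cdots\cup A_x)$. Then for each $1\le x\le k$, $$\sum_{i=1}^k|r_x(L_i)|\ge|\mathsf{OPT}|-g_x\qquad\text{and}\qquad k|A_x|+g_{x-1}\ge|\mathsf{OPT}|.$$
   Context: Subsequences of $\omega$ are identified with sets of positions of $\omega$; $|\alpha|$ denotes the length of a subsequence $\alpha$. The $k$-LIS problem asks for $k$ pairwise disjoint (position-disjoint) increasing subsequences of $\omega$ maximizing their total length. The greedy algorithm: for $i=1,\dots,k$, choose a longest increasing subsequence $A_i$ of the current sequence (any one if several), output it, and remove its elements from the sequence. For a subsequence $L$, $L\setminus B$ denotes the subsequence of $L$ consisting of its positions not in $B$ (still increasing). -}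

module Defs where

open import Data.Nat using (ℕ; zero; suc; _+_; _≤_)
open import Data.Integer as ℤ using (ℤ)
open import Data.Fin as Fin using (Fin; zero; suc; toℕ)
open import Data.Fin.Subset using (Subset; _∈_; _∪_; ⊥; ∣_∣)
open import Data.Product using (_×_)
open import Relation.Binary.PropositionalEquality using (_≢_)
open import Function using (_∘_)

Seq : ℕ → Set
Seq n = Fin n → ℤ

-- A subsequence is a set of positions; it is increasing if
-- positions i < j in it carry values ω i < ω j (strictly increasing).
Increasing : ∀ {n} → Seq n → Subset n → Set
Increasing ω S = ∀ {i j} → i ∈ S → j ∈ S → i Fin.< j → ω i ℤ.< ω j

Disjoint : ∀ {n} → Subset n → Subset n → Set
Disjoint S T = ∀ {i} → i ∈ S → i ∈ T → Data.Empty.⊥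
  where import Data.Empty

sumFin : ∀ {k} → (Fin k → ℕ) → ℕ
sumFin {zero} f = 0
sumFin {suc k} f = f zero + sumFin (f ∘ suc)

-- sum of the first x values f 0 + ... + f (x-1)  (capped at k)
sumFirst : ∀ {k} → (Fin k → ℕ) → ℕ → ℕ
sumFirst {zero} f x = 0
sumFirst {suc k} f zero = 0
sumFirst {suc k} f (suc x) = f zero + sumFirst (f ∘ suc) x

unionFirst : ∀ {k n} → (Fin k → Subset n) → ℕ → Subset n
unionFirst {zero} A x = ⊥
unionFirst {suc k} A zero = ⊥
unionFirst {suc k} A (suc x) = A zero ∪ unionFirst (A ∘ suc) x

IsKLIS : ∀ {n} → Seq n → (k : ℕ) → (Fin k → Subset n) → Set
IsKLIS ω k L = (∀ i → Increasing ω (L i)) × (∀ i j → i ≢ j → Disjoint (L i) (L j))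

totalLength : ∀ {n k} → (Fin k → Subset n) → ℕ
totalLength L = sumFin (λ i → ∣ L i ∣)

IsOptimalKLIS : ∀ {n} → Seq n → (k : ℕ) → (Fin k → Subset n) → Set
IsOptimalKLIS ω k L =
  IsKLIS ω k L × (∀ L′ → IsKLIS ω k L′ → totalLength L′ ≤ totalLength L)

-- A (0-indexed: A x is the paper's A_{x+1}) is a possible output of the greedy
-- algorithm: each A x is a longest increasing subsequence of ω with the
-- positions of A 0, ..., A (x-1) removed.
IsGreedy : ∀ {n} → Seq n → (k : ℕ) → (Fin k → Subset n) → Set
IsGreedy ω k A = ∀ (x : Fin k) →
  Increasing ω (A x) × Disjoint (A x) (unionFirst A (toℕ x)) ×
  (∀ S → Increasing ω S → Disjoint S (unionFirst A (toℕ x)) → ∣ S ∣ ≤ ∣ A x ∣)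

{-# OPTIONS --safe #-}
-- Removing a set U of positions from pairwise disjoint subsequences L_i shortens
-- them by at most |U| in total, and A_1 ∪ ⋯ ∪ A_x has at most g_x positions; this
-- gives the first inequality.  For the second, each residual r_{x-1}(L_i) is an
-- increasing subsequence avoiding A_1, …, A_{x-1}, so the greedy choice of A_x
-- makes |r_{x-1}(L_i)| ≤ |A_x|.
module Submission where

open import Defs
open import Data.Nat using (ℕ; zero; suc; _+_; _*_; _≤_; _≥_; z≤n; s≤s)
open import Data.Nat.Properties
  using ( +-suc; +-comm; n≤1+n; ≤-reflexive; ≤-trans; +-mono-≤; +-monoˡ-≤; +-monoʳ-≤
        ; +-commutativeSemigroup; module ≤-Reasoning)
open import Data.Fin using (Fin; zero; suc; toℕ)
open import Data.Fin.Properties using (suc-injective)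
open import Data.Fin.Subset using (Subset; _∈_; _∉_; _∩_; _∪_; _─_; _⊆_; ∣_∣; inside; outside)
open import Data.Fin.Subset.Properties
  using (x∈p∩q⁺; x∈p∩q⁻; ∩-comm; p⊆q⇒∣p∣≤∣q∣; p─q⊆p; x∈p∧x∉q⇒x∈p─q; ∣⊥∣≡0)
open import Data.Vec.Base using ([]; _∷_; here; there)
open import Data.Product using (_×_; _,_)
open import Relation.Binary.PropositionalEquality
open import Function using (_∘_)
open import Algebra.Properties.CommutativeSemigroup +-commutativeSemigroup using (interchange)

x∈p─q⇒x∉q : ∀ {n} {x : Fin n} (p q : Subset n) → x ∈ p ─ q → x ∉ q
x∈p─q⇒x∉q (inside ∷ p) (outside ∷ q) here ()
x∈p─q⇒x∉q (_ ∷ p) (_ ∷ q) (there x∈p─q) (there x∈q) = x∈p─q⇒x∉q p q x∈p─q x∈q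

∣p∣≡∣p─q∣+∣p∩q∣ : ∀ {n} (p q : Subset n) → ∣ p ∣ ≡ ∣ p ─ q ∣ + ∣ p ∩ q ∣
∣p∣≡∣p─q∣+∣p∩q∣ []            []            = refl
∣p∣≡∣p─q∣+∣p∩q∣ (inside  ∷ p) (inside  ∷ q) = trans (cong suc (∣p∣≡∣p─q∣+∣p∩q∣ p q)) (sym (+-suc _ _))
∣p∣≡∣p─q∣+∣p∩q∣ (inside  ∷ p) (outside ∷ q) = cong suc (∣p∣≡∣p─q∣+∣p∩q∣ p q)
∣p∣≡∣p─q∣+∣p∩q∣ (outside ∷ p) (inside  ∷ q) = ∣p∣≡∣p─q∣+∣p∩q∣ p q
∣p∣≡∣p─q∣+∣p∩q∣ (outside ∷ p) (outside ∷ q) = ∣p∣≡∣p─q∣+∣p∩q∣ p q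

∣p∪q∣≤∣p∣+∣q∣ : ∀ {n} (p q : Subset n) → ∣ p ∪ q ∣ ≤ ∣ p ∣ + ∣ q ∣
∣p∪q∣≤∣p∣+∣q∣ []            []            = z≤n
∣p∪q∣≤∣p∣+∣q∣ (inside  ∷ p) (inside  ∷ q) = s≤s (≤-trans (∣p∪q∣≤∣p∣+∣q∣ p q) (+-monoʳ-≤ ∣ p ∣ (n≤1+n ∣ q ∣)))
∣p∪q∣≤∣p∣+∣q∣ (inside  ∷ p) (outside ∷ q) = s≤s (∣p∪q∣≤∣p∣+∣q∣ p q)
∣p∪q∣≤∣p∣+∣q∣ (outside ∷ p) (inside  ∷ q) = ≤-trans (s≤s (∣p∪q∣≤∣p∣+∣q∣ p q)) (≤-reflexive (sym (+-suc ∣ p ∣ ∣ q ∣)))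
∣p∪q∣≤∣p∣+∣q∣ (outside ∷ p) (outside ∷ q) = ∣p∪q∣≤∣p∣+∣q∣ p q

sumFin-cong : ∀ {k} {f g : Fin k → ℕ} → (∀ i → f i ≡ g i) → sumFin f ≡ sumFin g
sumFin-cong {zero}  f≗g = refl
sumFin-cong {suc k} f≗g = cong₂ _+_ (f≗g zero) (sumFin-cong (f≗g ∘ suc))

sumFin-mono-≤ : ∀ {k} {f g : Fin k → ℕ} → (∀ i → f i ≤ g i) → sumFin f ≤ sumFin g
sumFin-mono-≤ {zero}  f≤g = z≤n
sumFin-mono-≤ {suc k} f≤g = +-mono-≤ (f≤g zero) (sumFin-mono-≤ (f≤g ∘ suc))

sumFin-distrib-+ : ∀ {k} (f g : Fin k → ℕ) → sumFin (λ i → f i + g i) ≡ sumFin f + sumFin g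
sumFin-distrib-+ {zero}  f g = refl
sumFin-distrib-+ {suc k} f g = begin
  f zero + g zero + sumFin (λ i → f (suc i) + g (suc i))
    ≡⟨ cong (f zero + g zero +_) (sumFin-distrib-+ (f ∘ suc) (g ∘ suc)) ⟩
  f zero + g zero + (sumFin (f ∘ suc) + sumFin (g ∘ suc))
    ≡⟨ interchange (f zero) (g zero) (sumFin (f ∘ suc)) (sumFin (g ∘ suc)) ⟩
  f zero + sumFin (f ∘ suc) + (g zero + sumFin (g ∘ suc)) ∎
  where open ≡-Reasoning

sumFin-const : ∀ {k} c → sumFin {k} (λ _ → c) ≡ k * c
sumFin-const {zero}  c = refl
sumFin-const {suc k} c = cong (c +_) (sumFin-const {k} c)

∣unionFirst∣≤sumFirst : ∀ {k n} (A : Fin k → Subset n) m →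
  ∣ unionFirst A m ∣ ≤ sumFirst (λ i → ∣ A i ∣) m
∣unionFirst∣≤sumFirst {zero}  {n} A m       = ≤-reflexive (∣⊥∣≡0 n)
∣unionFirst∣≤sumFirst {suc k} {n} A zero    = ≤-reflexive (∣⊥∣≡0 n)
∣unionFirst∣≤sumFirst {suc k}     A (suc m) =
  ≤-trans (∣p∪q∣≤∣p∣+∣q∣ (A zero) _) (+-monoʳ-≤ ∣ A zero ∣ (∣unionFirst∣≤sumFirst (A ∘ suc) m))

PairwiseDisjoint : ∀ {k n} → (Fin k → Subset n) → Set
PairwiseDisjoint L = ∀ i j → i ≢ j → Disjoint (L i) (L j)

sumFin-∣∩∣≤ : ∀ {k n} {L : Fin k → Subset n} → PairwiseDisjoint L → ∀ U →
  sumFin (λ i → ∣ L i ∩ U ∣) ≤ ∣ U ∣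
sumFin-∣∩∣≤ {zero}          disjoint U = z≤n
sumFin-∣∩∣≤ {suc k} {L = L} disjoint U = begin
  ∣ L zero ∩ U ∣ + sumFin (λ i → ∣ L (suc i) ∩ U ∣)
    ≤⟨ +-monoʳ-≤ ∣ L zero ∩ U ∣ (sumFin-mono-≤ (p⊆q⇒∣p∣≤∣q∣ ∘ tail⊆)) ⟩
  ∣ L zero ∩ U ∣ + sumFin (λ i → ∣ L (suc i) ∩ (U ─ L zero) ∣)
    ≤⟨ +-monoʳ-≤ ∣ L zero ∩ U ∣ (sumFin-∣∩∣≤ tail-disjoint (U ─ L zero)) ⟩
  ∣ L zero ∩ U ∣ + ∣ U ─ L zero ∣
    ≡⟨ cong (_+ ∣ U ─ L zero ∣) (cong ∣_∣ (∩-comm (L zero) U)) ⟩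
  ∣ U ∩ L zero ∣ + ∣ U ─ L zero ∣
    ≡⟨ +-comm ∣ U ∩ L zero ∣ ∣ U ─ L zero ∣ ⟩
  ∣ U ─ L zero ∣ + ∣ U ∩ L zero ∣
    ≡⟨ ∣p∣≡∣p─q∣+∣p∩q∣ U (L zero) ⟨
  ∣ U ∣ ∎
  where
  open ≤-Reasoning
  tail-disjoint : PairwiseDisjoint (L ∘ suc)
  tail-disjoint i j i≢j = disjoint (suc i) (suc j) (i≢j ∘ suc-injective)
  tail⊆ : ∀ i → L (suc i) ∩ U ⊆ L (suc i) ∩ (U ─ L zero)
  tail⊆ i x∈L∩U with x∈p∩q⁻ (L (suc i)) U x∈L∩U
  ... | x∈L , x∈U = x∈p∩q⁺ (x∈L , x∈p∧x∉q⇒x∈p─q x∈U (disjoint (suc i) zero (λ ()) x∈L))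

totalLength≤sumFin-∣─∣+∣∣ : ∀ {k n} {L : Fin k → Subset n} → PairwiseDisjoint L → ∀ U →
  totalLength L ≤ sumFin (λ i → ∣ L i ─ U ∣) + ∣ U ∣
totalLength≤sumFin-∣─∣+∣∣ {L = L} disjoint U = begin
  totalLength L
    ≡⟨ sumFin-cong (λ i → ∣p∣≡∣p─q∣+∣p∩q∣ (L i) U) ⟩
  sumFin (λ i → ∣ L i ─ U ∣ + ∣ L i ∩ U ∣)
    ≡⟨ sumFin-distrib-+ (λ i → ∣ L i ─ U ∣) (λ i → ∣ L i ∩ U ∣) ⟩
  sumFin (λ i → ∣ L i ─ U ∣) + sumFin (λ i → ∣ L i ∩ U ∣)
    ≤⟨ +-monoʳ-≤ _ (sumFin-∣∩∣≤ disjoint U) ⟩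
  sumFin (λ i → ∣ L i ─ U ∣) + ∣ U ∣ ∎
  where open ≤-Reasoning

totalLength≤residual+sumFirst : ∀ {k k′ n} {L : Fin k → Subset n} → PairwiseDisjoint L →
  (A : Fin k′ → Subset n) → ∀ m →
  totalLength L ≤ sumFin (λ i → ∣ L i ─ unionFirst A m ∣) + sumFirst (λ i → ∣ A i ∣) m
totalLength≤residual+sumFirst disjoint A m =
  ≤-trans (totalLength≤sumFin-∣─∣+∣∣ disjoint (unionFirst A m)) (+-monoʳ-≤ _ (∣unionFirst∣≤sumFirst A m))

Increasing-⊆ : ∀ {n} {ω : Seq n} {S T : Subset n} → S ⊆ T → Increasing ω T → Increasing ω S
Increasing-⊆ S⊆T increasing i∈S j∈S = increasing (S⊆T i∈S) (S⊆T j∈S)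

IsGreedy⇒∣─unionFirst∣≤ : ∀ {n k} {ω : Seq n} {A : Fin k → Subset n} → IsGreedy ω k A →
  ∀ x {S} → Increasing ω S → ∣ S ─ unionFirst A (toℕ x) ∣ ≤ ∣ A x ∣
IsGreedy⇒∣─unionFirst∣≤ {n} {A = A} greedy x {S} increasing with greedy x
... | _ , _ , longest = longest (S ─ U) (Increasing-⊆ (p─q⊆p S U) increasing) (x∈p─q⇒x∉q S U)
  where
  U : Subset n
  U = unionFirst A (toℕ x)

lemma3p1 : ∀ {n} (ω : Seq n) (k : ℕ) → 1 ≤ k →
    (L A : Fin k → Subset n) → IsOptimalKLIS ω k L → IsGreedy ω k A →
    ∀ (x : Fin k) →
      (sumFin (λ i → ∣ L i ─ unionFirst A (suc (toℕ x)) ∣) + sumFirst (λ i → ∣ A i ∣) (suc (toℕ x)) ≥ totalLength L)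
      × (k * ∣ A x ∣ + sumFirst (λ i → ∣ A i ∣) (toℕ x) ≥ totalLength L)
lemma3p1 ω k _ L A ((increasing , disjoint) , _) greedy x =
  totalLength≤residual+sumFirst disjoint A (suc (toℕ x)) , secondBound
  where
  open ≤-Reasoning
  prefixLength : ℕ
  prefixLength = sumFirst (λ i → ∣ A i ∣) (toℕ x)
  secondBound : totalLength L ≤ k * ∣ A x ∣ + prefixLength
  secondBound = begin
    totalLength L
      ≤⟨ totalLength≤residual+sumFirst disjoint A (toℕ x) ⟩
    sumFin (λ i → ∣ L i ─ unionFirst A (toℕ x) ∣) + prefixLength
      ≤⟨ +-monoˡ-≤ prefixLength (sumFin-mono-≤ (λ i → IsGreedy⇒∣─unionFirst∣≤ greedy x (increasing i))) ⟩
    sumFin {k} (λ _ → ∣ A x ∣) + prefixLength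
      ≡⟨ cong (_+ prefixLength) (sumFin-const {k} ∣ A x ∣) ⟩
    k * ∣ A x ∣ + prefixLength ∎
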